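{- If a tournament $T$ has an edge coloring with two colors such that, for each color, the digraph formed by the edges of that color is transitive, then $T$ is a transitive (acyclic) tournament.
   Context: A digraph is transitive if whenever $ab$ and $bc$ are edges, $ac$ is also an edge. -}

module Defs where

open import Data.Nat using (ℕ)
open import Data.Fin using (Fin)
open import Data.Bool using (Bool)
open import Data.Product using (Σ; _×_)
open import Data.Sum using (_⊎_)
open import Relation.Nullary using (¬_)
open import Relation.Binary.PropositionalEquality using (_≡_)

Digraph : ℕ → Set₁
Digraph n = Fin n → Fin n → Set

Transitive : ∀ {n} → Digraph n → Set
Transitive {n} E = ∀ (u v w : Fin n) → E u v → E v w → E u w

record IsTournament {n : ℕ} (T : Digraph n) : Set where
  field
    irreflexive : ∀ (u : Fin n) → ¬ T u u
    asymmetric  : ∀ (u v : Fin n) → T u v → ¬ T v u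
    complete    : ∀ (u v : Fin n) → ¬ u ≡ v → T u v ⊎ T v u
    -- edges carry no data: T u v is a proposition (a relation, not a multigraph)
    propositional : ∀ (u v : Fin n) (e e′ : T u v) → e ≡ e′

EdgeColouring : ∀ {n} → Digraph n → Set
EdgeColouring {n} T = ∀ (u v : Fin n) → T u v → Bool

ColourClass : ∀ {n} (T : Digraph n) → EdgeColouring T → Bool → Digraph n
ColourClass T c b u v = Σ (T u v) (λ e → c u v e ≡ b)

-- In a tournament, a path u → v → w whose edge w–u points back would be a
-- directed triangle.  Among its three edges two consecutive ones share a colour,
-- and transitivity of that colour class yields the reverse of the third edge,
-- contradicting asymmetry.  So every such path closes forward, i.e. T is transitive.
module Submission where

open import Defs
open import Data.Nat using (ℕ)
open import Data.Bool using (Bool; true; false)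
open import Data.Product using (Σ; _,_; proj₁)
open import Data.Sum using (_⊎_; inj₁; inj₂)
open import Data.Fin using (Fin)
open import Data.Fin.Properties using (_≟_)
open import Relation.Nullary using (¬_; yes; no; contradiction)
open import Relation.Binary.PropositionalEquality using (_≡_; refl)

cyclic-pair-agrees : ∀ (x y z : Bool) → x ≡ y ⊎ y ≡ z ⊎ z ≡ x
cyclic-pair-agrees false false _     = inj₁ refl
cyclic-pair-agrees true  true  _     = inj₁ refl
cyclic-pair-agrees false true  true  = inj₂ (inj₁ refl)
cyclic-pair-agrees true  false false = inj₂ (inj₁ refl)
cyclic-pair-agrees false true  false = inj₂ (inj₂ refl)
cyclic-pair-agrees true  false true  = inj₂ (inj₂ refl)

NoTriangle : ∀ {n} → Digraph n → Set
NoTriangle {n} E = ∀ (u v w : Fin n) → E u v → E v w → ¬ E w u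

module _ {n : ℕ} {T : Digraph n} (asym : ∀ u v → T u v → ¬ T v u)
         (c : EdgeColouring T) (trans : ∀ b → Transitive (ColourClass T c b)) where

  monochromatic-path-closes : ∀ u v w (uv : T u v) (vw : T v w) →
    c u v uv ≡ c v w vw → ¬ T w u
  monochromatic-path-closes u v w uv vw same wu =
    asym w u wu (proj₁ (trans (c v w vw) u v w (uv , same) (vw , refl)))

  two-colour-transitive⇒noTriangle : NoTriangle T
  two-colour-transitive⇒noTriangle u v w uv vw wu
    with cyclic-pair-agrees (c u v uv) (c v w vw) (c w u wu)
  ... | inj₁ uv~vw        = monochromatic-path-closes u v w uv vw uv~vw wu
  ... | inj₂ (inj₁ vw~wu) = monochromatic-path-closes v w u vw wu vw~wu uv
  ... | inj₂ (inj₂ wu~uv) = monochromatic-path-closes w u v wu uv wu~uv vw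

tournament-noTriangle⇒transitive : ∀ {n} {T : Digraph n} →
  IsTournament T → NoTriangle T → Transitive T
tournament-noTriangle⇒transitive tour noTriangle u v w uv vw with u ≟ w
... | yes refl = contradiction vw (IsTournament.asymmetric tour u v uv)
... | no u≢w with IsTournament.complete tour u w u≢w
...   | inj₁ uw = uw
...   | inj₂ wu = contradiction wu (noTriangle u v w uv vw)

proposition1p1 : ∀ (n : ℕ) (T : Digraph n) → IsTournament T →
    Σ (EdgeColouring T) (λ c → ∀ (b : Bool) → Transitive (ColourClass T c b)) →
    Transitive T
proposition1p1 n T tour (c , trans) =
  tournament-noTriangle⇒transitive tour
    (two-colour-transitive⇒noTriangle (IsTournament.asymmetric tour) c trans)
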